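{- Let $\Gamma$ be a distance-biregular graph on $n$ vertices with stable sets $V_0,V_1$ and equilibrium arrays $q_{\ell,i}$. Let $y\in V_\ell$ and $x\in V_{\hat\ell}$ with $\ell,\hat\ell\in\{0,1\}$. Then $$q_{\ell,d(x,y)}=q_{\hat\ell,d(x,y)}+(n-1)\left(\frac1{k_\ell}-\frac1{k_{\hat\ell}}\right).$$
   Context: Graphs are finite, connected, simple, $n=|V|\ge2$, $d$ the graph distance, $\Gamma_i(x)=\{y:d(x,y)=i\}$. Laplacian: $\mathcal L(u)(x)=\sum_{y\sim x}(u(x)-u(y))$. For $y\in V$, $\nu^y$ is the unique function with $\nu^y(y)=0$, $\nu^y(x)>0$ for $x\neq y$ and $\mathcal L(\nu^y)=\mathbf 1-n\varepsilon_y$. A distance-biregular graph is a connected bipartite graph with stable sets $V_0,V_1$, every vertex in $V_\ell$ of degree $k_\ell$, such that for vertices $x,y$ at distance $i$ the numbers $|\Gamma_{i-1}(x)\cap\Gamma_1(y)|$, $|\Gamma_{i+1}(x)\cap\Gamma_1(y)|$ depend only on $i$ and the stable set of $x$. $D_\ell=\max\{d(x,y):x\in V_\ell,y\in V\}$. The equilibrium arrays are the numbers $q_{\ell,m}$ ($\ell=0,1$, $m=0,\dots,D_\ell$) such that for $x\in V_\ell$, $\nu^x(y)=q_{\ell,m}$ if and only if $d(x,y)=m$ (these exist for distance-biregular graphs). -}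

module Defs where

open import Data.Nat as ℕ using (ℕ; zero; suc; _≡ᵇ_)
open import Data.Fin using (Fin; zero; suc)
open import Data.Fin.Properties using () renaming (_≟_ to _≟ᶠ_)
open import Data.Bool using (Bool; true; false; _∧_; _∨_; if_then_else_)
open import Data.Integer using (+_)
open import Data.Rational using (ℚ; _/_; 0ℚ; 1ℚ; _+_; _-_; _*_; _<_)
open import Data.Product using (_×_; ∃; Σ)
open import Relation.Binary.PropositionalEquality using (_≡_; _≢_)
open import Relation.Nullary.Decidable using (⌊_⌋)

Adj : ℕ → Set
Adj n = Fin n → Fin n → Bool

IsSimple : ∀ {n} → Adj n → Set
IsSimple {n} A = (∀ (x y : Fin n) → A x y ≡ A y x) × (∀ (x : Fin n) → A x x ≡ false)

anyV : ∀ {n} → (Fin n → Bool) → Bool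
anyV {zero} f = false
anyV {suc n} f = f zero ∨ anyV (λ i → f (suc i))

count : ∀ {n} → (Fin n → Bool) → ℕ
count {zero} f = 0
count {suc n} f = (if f zero then 1 else 0) ℕ.+ count (λ i → f (suc i))

sumℚ : ∀ {n} → (Fin n → ℚ) → ℚ
sumℚ {zero} f = 0ℚ
sumℚ {suc n} f = f zero + sumℚ (λ i → f (suc i))

reach : ∀ {n} → Adj n → ℕ → Fin n → Fin n → Bool
reach A zero x y = ⌊ x ≟ᶠ y ⌋
reach A (suc k) x y = reach A k x y ∨ anyV (λ z → reach A k x z ∧ A z y)

Connected : ∀ {n} → Adj n → Set
Connected {n} A = ∀ (x y : Fin n) → ∃ λ k → reach A k x y ≡ true

-- least k < b with f k = true (b if none)
search : (ℕ → Bool) → ℕ → ℕ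
search f zero = zero
search f (suc b) = if f zero then zero else suc (search (λ k → f (suc k)) b)

-- graph distance d(x,y): the least k with a walk of length ≤ k from x to y
-- (for a connected graph on n vertices this is < n, so the search bound n suffices)
dist : ∀ {n} → Adj n → Fin n → Fin n → ℕ
dist {n} A x y = search (λ k → reach A k x y) n

deg : ∀ {n} → Adj n → Fin n → ℕ
deg A x = count (A x)

IsBipartition : ∀ {n} → Adj n → (Fin n → Fin 2) → Set
IsBipartition {n} A part = ∀ (x y : Fin n) → A x y ≡ true → part x ≢ part y

cDown : ∀ {n} → Adj n → Fin n → Fin n → ℕ
cDown A x y = count (λ z → A y z ∧ (suc (dist A x z) ≡ᵇ dist A x y))

bUp : ∀ {n} → Adj n → Fin n → Fin n → ℕ
bUp A x y = count (λ z → A y z ∧ (dist A x z ≡ᵇ suc (dist A x y)))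

IsDistanceBiregular : ∀ {n} → Adj n → (Fin n → Fin 2) → (Fin 2 → ℕ) → Set
IsDistanceBiregular {n} A part k =
  Connected A × IsBipartition A part × (∀ (x : Fin n) → deg A x ≡ k (part x)) ×
  Σ (Fin 2 → ℕ → ℕ) λ c → Σ (Fin 2 → ℕ → ℕ) λ b →
    ∀ (x y : Fin n) → (cDown A x y ≡ c (part x) (dist A x y)) × (bUp A x y ≡ b (part x) (dist A x y))

ℕtoℚ : ℕ → ℚ
ℕtoℚ m = + m / 1

lap : ∀ {n} → Adj n → (Fin n → ℚ) → Fin n → ℚ
lap A u x = sumℚ (λ y → if A x y then u x - u y else 0ℚ)

eps : ∀ {n} → Fin n → Fin n → ℚ
eps y x = if ⌊ x ≟ᶠ y ⌋ then 1ℚ else 0ℚ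

IsEquilibriumMeasure : ∀ {n} → Adj n → Fin n → (Fin n → ℚ) → Set
IsEquilibriumMeasure {n} A y ν =
  (ν y ≡ 0ℚ) × (∀ (x : Fin n) → x ≢ y → 0ℚ < ν x) ×
  (∀ (x : Fin n) → lap A ν x ≡ 1ℚ - ℕtoℚ n * eps y x)

IsEquilibriumArray : ∀ {n} → Adj n → (Fin n → Fin 2) → (Fin n → Fin n → ℚ) → (Fin 2 → ℕ → ℚ) → Set
IsEquilibriumArray {n} A part ν q = ∀ (x y : Fin n) → ν x y ≡ q (part x) (dist A x y)

-- 1/k as a rational (k = 0 never occurs for the degrees in question)
inv : ℕ → ℚ
inv zero = 0ℚ
inv (suc k) = + 1 / suc k

-- Green's identity for the Laplacian makes equilibrium measures reciprocal:
-- n (ν^b(a) − ν^a(b)) = Σ ν^b − Σ ν^a.  In a distance-biregular graph ν^a(b) = ν^b(a)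
-- whenever a and b lie in the same stable set, so the total mass Σ ν^a only depends on
-- the stable set of a.  Comparing x with a neighbour w of y (which lies in the stable set
-- of x) therefore gives ν^y(x) − ν^x(y) = ν^y(w) − ν^w(y) = q_{ℓ,1} − q_{ℓ̂,1}, and
-- evaluating L(ν^v) = 1 − n ε_v at v gives k_ℓ q_{ℓ,1} = n − 1.
module Submission where

open import Defs
open import Data.Nat using (ℕ; _≤_; _∸_)
open import Data.Fin using (Fin)
open import Data.Rational using (ℚ; _+_; _-_; _*_)
open import Relation.Binary.PropositionalEquality using (_≡_)

open import Algebra.Bundles using (CommutativeRing)
open import Data.Bool using (Bool; true; false; _∧_; if_then_else_)
open import Data.Bool.Properties using (∨-zeroʳ; ∧-conicalˡ; ∧-conicalʳ)
open import Data.Empty using (⊥-elim)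
open import Data.Fin using (zero; suc)
open import Data.Fin.Properties using () renaming (_≟_ to _≟ᶠ_)
import Data.Integer as ℤ
import Data.Integer.Properties as ℤ
open import Data.Nat using (zero; suc; s≤s; z≤n)
import Data.Nat.Coprimality as Coprime
open import Data.Product using (∃; _×_; _,_; proj₁; proj₂)
open import Data.Rational using (mkℚ; 0ℚ; 1ℚ; -_)
open import Data.Rational.Properties using (normalize-coprime; *-inverseˡ; *-comm; *-zeroʳ; +-*-commutativeRing)
open import Data.Rational.Solver using (module +-*-Solver)
open import Data.Sum using (_⊎_; inj₁; inj₂)
open import Function using (_∘_)
open import Relation.Nullary using (yes; no)
open import Relation.Nullary.Decidable using (⌊_⌋)
open import Relation.Binary.PropositionalEquality
  using (refl; sym; trans; cong; cong₂; subst; _≢_; ≡-≟-identity; ≢-≟-identity; module ≡-Reasoning)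

open CommutativeRing +-*-commutativeRing using (semiring)
open import Algebra.Properties.Semiring.Sum semiring using (sum; sum-cong-≗; sum-replicate-zero; ∑-distrib-+; ∑-comm; *-distribˡ-sum)
open +-*-Solver
open ≡-Reasoning

ℕtoℚ≡mkℚ : ∀ m → ℕtoℚ m ≡ mkℚ (ℤ.+ m) 0 (Coprime.sym (Coprime.1-coprimeTo m))
ℕtoℚ≡mkℚ m = normalize-coprime (Coprime.sym (Coprime.1-coprimeTo m))

ℕtoℚ-suc : ∀ m → ℕtoℚ (suc m) ≡ 1ℚ + ℕtoℚ m
ℕtoℚ-suc m rewrite ℕtoℚ≡mkℚ m = cong (λ j → (ℤ.+ 1 ℤ.+ j) Data.Rational./ 1) (sym (ℤ.*-identityʳ (ℤ.+ m)))

ℕtoℚ-suc≢0 : ∀ m → ℕtoℚ (suc m) ≢ 0ℚ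
ℕtoℚ-suc≢0 m e with trans (sym (ℕtoℚ≡mkℚ (suc m))) e
... | ()

inv-*-ℕtoℚ : ∀ k → inv (suc k) * ℕtoℚ (suc k) ≡ 1ℚ
inv-*-ℕtoℚ k rewrite ℕtoℚ≡mkℚ (suc k) | normalize-coprime {1} {k} (Coprime.1-coprimeTo (suc k)) =
  *-inverseˡ (mkℚ (ℤ.+ suc k) 0 (Coprime.sym (Coprime.1-coprimeTo (suc k))))

ℕtoℚ-suc-*-cancelˡ : ∀ m {p q} → ℕtoℚ (suc m) * p ≡ ℕtoℚ (suc m) * q → p ≡ q
ℕtoℚ-suc-*-cancelˡ m {p} {q} e = begin
  p                 ≡⟨ solve 1 (λ p → p := con 1ℚ :* p) refl p ⟩
  1ℚ * p            ≡⟨ cong (_* p) (sym (inv-*-ℕtoℚ m)) ⟩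
  (I * K) * p       ≡⟨ solve 3 (λ I K p → (I :* K) :* p := I :* (K :* p)) refl I K p ⟩
  I * (K * p)       ≡⟨ cong (I *_) e ⟩
  I * (K * q)       ≡⟨ solve 3 (λ I K q → I :* (K :* q) := (I :* K) :* q) refl I K q ⟩
  (I * K) * q       ≡⟨ cong (_* q) (inv-*-ℕtoℚ m) ⟩
  1ℚ * q            ≡⟨ solve 1 (λ q → con 1ℚ :* q := q) refl q ⟩
  q                 ∎
  where I = inv (suc m); K = ℕtoℚ (suc m)

ℕtoℚ-*≡ℕtoℚ-suc⇒≢0 : ∀ d m {Q} → ℕtoℚ d * Q ≡ ℕtoℚ (suc m) → d ≢ 0
ℕtoℚ-*≡ℕtoℚ-suc⇒≢0 d m {Q} e refl =
  ℕtoℚ-suc≢0 m (trans (sym e) (solve 1 (λ Q → con 0ℚ :* Q := con 0ℚ) refl Q))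

ℕtoℚ-*≡⇒≡*inv : ∀ d m {Q} → ℕtoℚ d * Q ≡ ℕtoℚ (suc m) → Q ≡ ℕtoℚ (suc m) * inv d
ℕtoℚ-*≡⇒≡*inv zero    m {Q} e = ⊥-elim (ℕtoℚ-*≡ℕtoℚ-suc⇒≢0 zero m {Q} e refl)
ℕtoℚ-*≡⇒≡*inv (suc j) m {Q} e = ℕtoℚ-suc-*-cancelˡ j (begin
  ℕtoℚ (suc j) * Q                     ≡⟨ e ⟩
  ℕtoℚ (suc m)                         ≡⟨ solve 1 (λ M → M := M :* con 1ℚ) refl (ℕtoℚ (suc m)) ⟩
  ℕtoℚ (suc m) * 1ℚ                    ≡⟨ cong (ℕtoℚ (suc m) *_) (sym (inv-*-ℕtoℚ j)) ⟩
  ℕtoℚ (suc m) * (inv (suc j) * ℕtoℚ (suc j))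
    ≡⟨ solve 3 (λ M I K → M :* (I :* K) := K :* (M :* I)) refl (ℕtoℚ (suc m)) (inv (suc j)) (ℕtoℚ (suc j)) ⟩
  ℕtoℚ (suc j) * (ℕtoℚ (suc m) * inv (suc j)) ∎)

sumℚ≡sum : ∀ {n} (f : Fin n → ℚ) → sumℚ f ≡ sum f
sumℚ≡sum {zero}  f = refl
sumℚ≡sum {suc n} f = cong (f zero +_) (sumℚ≡sum (f ∘ suc))

sumℚ-cong : ∀ {n} {f g : Fin n → ℚ} → (∀ i → f i ≡ g i) → sumℚ f ≡ sumℚ g
sumℚ-cong {f = f} {g} f≗g = trans (sumℚ≡sum f) (trans (sum-cong-≗ f≗g) (sym (sumℚ≡sum g)))

sumℚ-distrib-+ : ∀ {n} (f g : Fin n → ℚ) → sumℚ (λ i → f i + g i) ≡ sumℚ f + sumℚ g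
sumℚ-distrib-+ f g = begin
  sumℚ (λ i → f i + g i) ≡⟨ sumℚ≡sum (λ i → f i + g i) ⟩
  sum (λ i → f i + g i)  ≡⟨ ∑-distrib-+ f g ⟩
  sum f + sum g          ≡⟨ sym (cong₂ _+_ (sumℚ≡sum f) (sumℚ≡sum g)) ⟩
  sumℚ f + sumℚ g        ∎

*-distribˡ-sumℚ : ∀ {n} c (f : Fin n → ℚ) → c * sumℚ f ≡ sumℚ (λ i → c * f i)
*-distribˡ-sumℚ c f = begin
  c * sumℚ f             ≡⟨ cong (c *_) (sumℚ≡sum f) ⟩
  c * sum f              ≡⟨ *-distribˡ-sum c f ⟩
  sum (λ i → c * f i)    ≡⟨ sym (sumℚ≡sum (λ i → c * f i)) ⟩
  sumℚ (λ i → c * f i)   ∎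

sumℚ-distrib-- : ∀ {n} (f g : Fin n → ℚ) → sumℚ (λ i → f i - g i) ≡ sumℚ f - sumℚ g
sumℚ-distrib-- f g = begin
  sumℚ (λ i → f i - g i)           ≡⟨ sumℚ-cong (λ i → solve 2 (λ a b → a :- b := a :+ con (- 1ℚ) :* b) refl (f i) (g i)) ⟩
  sumℚ (λ i → f i + - 1ℚ * g i)      ≡⟨ sumℚ-distrib-+ f _ ⟩
  sumℚ f + sumℚ (λ i → - 1ℚ * g i)   ≡⟨ cong (sumℚ f +_) (sym (*-distribˡ-sumℚ (- 1ℚ) g)) ⟩
  sumℚ f + - 1ℚ * sumℚ g             ≡⟨ solve 2 (λ a b → a :+ con (- 1ℚ) :* b := a :- b) refl (sumℚ f) (sumℚ g) ⟩
  sumℚ f - sumℚ g                  ∎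

sumℚ-comm : ∀ {m n} (F : Fin m → Fin n → ℚ) →
            sumℚ (λ i → sumℚ (F i)) ≡ sumℚ (λ j → sumℚ (λ i → F i j))
sumℚ-comm F = begin
  sumℚ (λ i → sumℚ (F i))            ≡⟨ trans (sumℚ≡sum (λ i → sumℚ (F i))) (sum-cong-≗ (λ i → sumℚ≡sum (F i))) ⟩
  sum (λ i → sum (F i))              ≡⟨ ∑-comm F ⟩
  sum (λ j → sum (λ i → F i j))      ≡⟨ sym (trans (sumℚ≡sum (λ j → sumℚ (λ i → F i j))) (sum-cong-≗ (λ j → sumℚ≡sum (λ i → F i j)))) ⟩
  sumℚ (λ j → sumℚ (λ i → F i j))    ∎

sumℚ-zero : ∀ n → sumℚ {n} (λ _ → 0ℚ) ≡ 0ℚ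
sumℚ-zero n = trans (sumℚ≡sum {n} (λ _ → 0ℚ)) (sum-replicate-zero n)

eps-refl : ∀ {n} (y : Fin n) → eps y y ≡ 1ℚ
eps-refl y = cong (λ d → if ⌊ d ⌋ then 1ℚ else 0ℚ) (≡-≟-identity _≟ᶠ_ refl)

eps-suc : ∀ {n} (b i : Fin n) → eps {suc n} (suc b) (suc i) ≡ eps b i
eps-suc b i with i ≟ᶠ b
... | yes _ = refl
... | no  _ = refl

sumℚ-*-eps : ∀ {n} (f : Fin n → ℚ) b → sumℚ (λ z → f z * eps b z) ≡ f b
sumℚ-*-eps {suc n} f zero = begin
  f zero * 1ℚ + sumℚ (λ i → f (suc i) * 0ℚ) ≡⟨ cong (f zero * 1ℚ +_) (sumℚ-cong (λ i → *-zeroʳ (f (suc i)))) ⟩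
  f zero * 1ℚ + sumℚ (λ (_ : Fin n) → 0ℚ)   ≡⟨ cong (f zero * 1ℚ +_) (sumℚ-zero n) ⟩
  f zero * 1ℚ + 0ℚ                           ≡⟨ solve 1 (λ a → a :* con 1ℚ :+ con 0ℚ := a) refl (f zero) ⟩
  f zero                                     ∎
sumℚ-*-eps {suc n} f (suc b) = begin
  f zero * 0ℚ + sumℚ (λ i → f (suc i) * eps (suc b) (suc i))
    ≡⟨ cong (f zero * 0ℚ +_) (sumℚ-cong (λ i → cong (f (suc i) *_) (eps-suc b i))) ⟩
  f zero * 0ℚ + sumℚ (λ i → f (suc i) * eps b i)
    ≡⟨ cong (f zero * 0ℚ +_) (sumℚ-*-eps (f ∘ suc) b) ⟩
  f zero * 0ℚ + f (suc b) ≡⟨ solve 2 (λ a c → a :* con 0ℚ :+ c := c) refl (f zero) (f (suc b)) ⟩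
  f (suc b)               ∎

sumℚ-if-count : ∀ {n} (f : Fin n → Bool) c → sumℚ (λ z → if f z then c else 0ℚ) ≡ ℕtoℚ (count f) * c
sumℚ-if-count {zero}  f c = solve 1 (λ c → con 0ℚ := con 0ℚ :* c) refl c
sumℚ-if-count {suc n} f c with f zero
... | true  = begin
  c + sumℚ (λ i → if f (suc i) then c else 0ℚ) ≡⟨ cong (c +_) (sumℚ-if-count (f ∘ suc) c) ⟩
  c + ℕtoℚ (count (f ∘ suc)) * c               ≡⟨ solve 2 (λ c m → c :+ m :* c := (con 1ℚ :+ m) :* c) refl c (ℕtoℚ (count (f ∘ suc))) ⟩
  (1ℚ + ℕtoℚ (count (f ∘ suc))) * c            ≡⟨ cong (_* c) (sym (ℕtoℚ-suc (count (f ∘ suc)))) ⟩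
  ℕtoℚ (suc (count (f ∘ suc))) * c             ∎
... | false = begin
  0ℚ + sumℚ (λ i → if f (suc i) then c else 0ℚ) ≡⟨ cong (0ℚ +_) (sumℚ-if-count (f ∘ suc) c) ⟩
  0ℚ + ℕtoℚ (count (f ∘ suc)) * c               ≡⟨ solve 1 (λ a → con 0ℚ :+ a := a) refl (ℕtoℚ (count (f ∘ suc)) * c) ⟩
  ℕtoℚ (count (f ∘ suc)) * c                    ∎

count≢0⇒∃ : ∀ {n} (f : Fin n → Bool) → count f ≢ 0 → ∃ λ z → f z ≡ true
count≢0⇒∃ {zero}  f c = ⊥-elim (c refl)
count≢0⇒∃ {suc n} f c with f zero in e
... | true  = zero , e
... | false = let z , p = count≢0⇒∃ (f ∘ suc) c in suc z , p

*-if-minus : ∀ b p q r → p * (if b then q - r else 0ℚ) ≡ (if b then p * q else 0ℚ) - (if b then p * r else 0ℚ)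
*-if-minus true  p q r = solve 3 (λ p q r → p :* (q :- r) := p :* q :- p :* r) refl p q r
*-if-minus false p q r = solve 1 (λ p → p :* con 0ℚ := con 0ℚ :- con 0ℚ) refl p

lap-selfAdjoint : ∀ {n} (A : Adj n) → (∀ x y → A x y ≡ A y x) →
                  ∀ u v → sumℚ (λ z → u z * lap A v z) ≡ sumℚ (λ z → v z * lap A u z)
lap-selfAdjoint {n} A A-sym u v = begin
  sumℚ (λ z → u z * lap A v z) ≡⟨ split u v ⟩
  diag u v - off u v           ≡⟨ cong₂ _-_ diag-sym off-sym ⟩
  diag v u - off v u           ≡⟨ sym (split v u) ⟩
  sumℚ (λ z → v z * lap A u z) ∎
  where
  diagRow offRow : (Fin n → ℚ) → (Fin n → ℚ) → Fin n → ℚ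
  diagRow u v z = sumℚ λ w → if A z w then u z * v z else 0ℚ
  offRow  u v z = sumℚ λ w → if A z w then u z * v w else 0ℚ

  diag off : (Fin n → ℚ) → (Fin n → ℚ) → ℚ
  diag u v = sumℚ (diagRow u v)
  off  u v = sumℚ (offRow u v)

  split : ∀ u v → sumℚ (λ z → u z * lap A v z) ≡ diag u v - off u v
  split u v = trans (sumℚ-cong row) (sumℚ-distrib-- (diagRow u v) (offRow u v))
    where
    row : ∀ z → u z * lap A v z ≡ diagRow u v z - offRow u v z
    row z = begin
      u z * lap A v z
        ≡⟨ *-distribˡ-sumℚ (u z) (λ w → if A z w then v z - v w else 0ℚ) ⟩
      sumℚ (λ w → u z * (if A z w then v z - v w else 0ℚ))
        ≡⟨ sumℚ-cong (λ w → *-if-minus (A z w) (u z) (v z) (v w)) ⟩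
      sumℚ (λ w → (if A z w then u z * v z else 0ℚ) - (if A z w then u z * v w else 0ℚ))
        ≡⟨ sumℚ-distrib-- (λ w → if A z w then u z * v z else 0ℚ) (λ w → if A z w then u z * v w else 0ℚ) ⟩
      diagRow u v z - offRow u v z ∎

  diag-sym : diag u v ≡ diag v u
  diag-sym = sumℚ-cong λ z → sumℚ-cong λ w → cong (λ t → if A z w then t else 0ℚ) (*-comm (u z) (v z))

  off-sym : off u v ≡ off v u
  off-sym = trans (sumℚ-comm (λ z w → if A z w then u z * v w else 0ℚ))
                  (sumℚ-cong λ w → sumℚ-cong λ z → cong₂ (λ a t → if a then t else 0ℚ) (A-sym z w) (*-comm (u z) (v w)))

sumℚ-*-equilibrium : ∀ {n} c (u : Fin n → ℚ) b → sumℚ (λ z → u z * (1ℚ - c * eps b z)) ≡ sumℚ u - c * u b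
sumℚ-*-equilibrium c u b = begin
  sumℚ (λ z → u z * (1ℚ - c * eps b z))
    ≡⟨ sumℚ-cong (λ z → solve 3 (λ u c e → u :* (con 1ℚ :- c :* e) := u :- c :* (u :* e)) refl (u z) c (eps b z)) ⟩
  sumℚ (λ z → u z - c * (u z * eps b z))     ≡⟨ sumℚ-distrib-- u (λ z → c * (u z * eps b z)) ⟩
  sumℚ u - sumℚ (λ z → c * (u z * eps b z))  ≡⟨ cong (λ t → sumℚ u - t) (sym (*-distribˡ-sumℚ c (λ z → u z * eps b z))) ⟩
  sumℚ u - c * sumℚ (λ z → u z * eps b z)    ≡⟨ cong (λ t → sumℚ u - c * t) (sumℚ-*-eps u b) ⟩
  sumℚ u - c * u b                           ∎

equilibrium-reciprocity : ∀ {n} {A : Adj n} → (∀ x y → A x y ≡ A y x) → ∀ {a b μ ν} →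
                          IsEquilibriumMeasure A a μ → IsEquilibriumMeasure A b ν →
                          ℕtoℚ n * (ν a - μ b) ≡ sumℚ ν - sumℚ μ
equilibrium-reciprocity {n} {A} A-sym {a} {b} {μ} {ν} (_ , _ , Lμ) (_ , _ , Lν) = begin
  N * (ν a - μ b)
    ≡⟨ solve 4 (λ N νa μb Sμ → N :* (νa :- μb) := (Sμ :- N :* μb) :+ (N :* νa :- Sμ)) refl N (ν a) (μ b) (sumℚ μ) ⟩
  (sumℚ μ - N * μ b) + (N * ν a - sumℚ μ)
    ≡⟨ cong (_+ (N * ν a - sumℚ μ)) green ⟩
  (sumℚ ν - N * ν a) + (N * ν a - sumℚ μ)
    ≡⟨ solve 4 (λ N νa Sμ Sν → (Sν :- N :* νa) :+ (N :* νa :- Sμ) := Sν :- Sμ) refl N (ν a) (sumℚ μ) (sumℚ ν) ⟩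
  sumℚ ν - sumℚ μ ∎
  where
  N = ℕtoℚ n
  green : sumℚ μ - N * μ b ≡ sumℚ ν - N * ν a
  green = begin
    sumℚ μ - N * μ b                      ≡⟨ sym (sumℚ-*-equilibrium N μ b) ⟩
    sumℚ (λ z → μ z * (1ℚ - N * eps b z)) ≡⟨ sumℚ-cong (λ z → cong (μ z *_) (sym (Lν z))) ⟩
    sumℚ (λ z → μ z * lap A ν z)          ≡⟨ lap-selfAdjoint A A-sym μ ν ⟩
    sumℚ (λ z → ν z * lap A μ z)          ≡⟨ sumℚ-cong (λ z → cong (ν z *_) (Lμ z)) ⟩
    sumℚ (λ z → ν z * (1ℚ - N * eps a z)) ≡⟨ sumℚ-*-equilibrium N ν a ⟩
    sumℚ ν - N * ν a                      ∎

equilibrium-mass-≡ : ∀ {n} {A : Adj n} → (∀ x y → A x y ≡ A y x) → ∀ {a b μ ν} →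
                     IsEquilibriumMeasure A a μ → IsEquilibriumMeasure A b ν →
                     ν a ≡ μ b → sumℚ μ ≡ sumℚ ν
equilibrium-mass-≡ {n} A-sym {a} {b} {μ} {ν} μ-eq ν-eq νa≡μb = begin
  sumℚ μ                            ≡⟨ solve 2 (λ Sμ Sν → Sμ := Sν :- (Sν :- Sμ)) refl (sumℚ μ) (sumℚ ν) ⟩
  sumℚ ν - (sumℚ ν - sumℚ μ)        ≡⟨ cong (λ t → sumℚ ν - t) (sym (equilibrium-reciprocity A-sym μ-eq ν-eq)) ⟩
  sumℚ ν - ℕtoℚ n * (ν a - μ b)     ≡⟨ cong (λ t → sumℚ ν - ℕtoℚ n * (t - μ b)) νa≡μb ⟩
  sumℚ ν - ℕtoℚ n * (μ b - μ b)     ≡⟨ solve 3 (λ Sν N x → Sν :- N :* (x :- x) := Sν) refl (sumℚ ν) (ℕtoℚ n) (μ b) ⟩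
  sumℚ ν                            ∎

lap-at-centre : ∀ {n} (A : Adj n) (u : Fin n → ℚ) y {Q} → u y ≡ 0ℚ → (∀ z → A y z ≡ true → u z ≡ Q) →
                lap A u y ≡ ℕtoℚ (deg A y) * (0ℚ - Q)
lap-at-centre A u y {Q} uy≡0 neighbours = trans (sumℚ-cong term) (sumℚ-if-count (A y) (0ℚ - Q))
  where
  term : ∀ z → (if A y z then u y - u z else 0ℚ) ≡ (if A y z then 0ℚ - Q else 0ℚ)
  term z with A y z in a
  ... | true  = cong₂ _-_ uy≡0 (neighbours z a)
  ... | false = refl

equilibrium-at-centre : ∀ {n} {A : Adj (suc n)} {y μ Q} → IsEquilibriumMeasure A y μ →
                         (∀ z → A y z ≡ true → μ z ≡ Q) → ℕtoℚ (deg A y) * Q ≡ ℕtoℚ n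
equilibrium-at-centre {n} {A} {y} {μ} {Q} (μy≡0 , _ , Lμ) neighbours = begin
  K * Q                            ≡⟨ solve 2 (λ K Q → K :* Q := con 0ℚ :- K :* (con 0ℚ :- Q)) refl K Q ⟩
  0ℚ - K * (0ℚ - Q)                ≡⟨ cong (λ t → 0ℚ - t) (sym (lap-at-centre A μ y μy≡0 neighbours)) ⟩
  0ℚ - lap A μ y                   ≡⟨ cong (λ t → 0ℚ - t) (Lμ y) ⟩
  0ℚ - (1ℚ - ℕtoℚ (suc n) * eps y y) ≡⟨ cong₂ (λ s e → 0ℚ - (1ℚ - s * e)) (ℕtoℚ-suc n) (eps-refl y) ⟩
  0ℚ - (1ℚ - (1ℚ + ℕtoℚ n) * 1ℚ)   ≡⟨ solve 1 (λ m → con 0ℚ :- (con 1ℚ :- (con 1ℚ :+ m) :* con 1ℚ) := m) refl (ℕtoℚ n) ⟩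
  ℕtoℚ n                           ∎
  where K = ℕtoℚ (deg A y)

anyV-true⇒∃ : ∀ {n} (f : Fin n → Bool) → anyV f ≡ true → ∃ λ z → f z ≡ true
anyV-true⇒∃ {suc n} f h with f zero in e
... | true  = zero , e
... | false = let z , p = anyV-true⇒∃ (f ∘ suc) h in suc z , p

∃⇒anyV-true : ∀ {n} (f : Fin n → Bool) z → f z ≡ true → anyV f ≡ true
∃⇒anyV-true f zero    e rewrite e = refl
∃⇒anyV-true f (suc z) e with f zero
... | true  = refl
... | false = ∃⇒anyV-true (f ∘ suc) z e

module _ {n} (A : Adj n) where

  reach-zero : ∀ {x y} → reach A 0 x y ≡ true → x ≡ y
  reach-zero {x} {y} h with x ≟ᶠ y
  ... | yes x≡y = x≡y

  reach-refl : ∀ k x → reach A k x x ≡ true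
  reach-refl zero    x = cong ⌊_⌋ (≡-≟-identity _≟ᶠ_ refl)
  reach-refl (suc k) x rewrite reach-refl k x = refl

  reach-weaken : ∀ k {x y} → reach A k x y ≡ true → reach A (suc k) x y ≡ true
  reach-weaken k h rewrite h = refl

  reach-snoc : ∀ k {x z y} → reach A k x z ≡ true → A z y ≡ true → reach A (suc k) x y ≡ true
  reach-snoc k {x} {z} {y} r a
    rewrite ∃⇒anyV-true (λ z′ → reach A k x z′ ∧ A z′ y) z (cong₂ _∧_ r a) = ∨-zeroʳ (reach A k x y)

  reach-suc-elim : ∀ k {x y} → reach A (suc k) x y ≡ true →
                   reach A k x y ≡ true ⊎ ∃ λ z → reach A k x z ≡ true × A z y ≡ true
  reach-suc-elim k {x} {y} h with reach A k x y in r
  ... | true  = inj₁ refl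
  ... | false = let z , p = anyV-true⇒∃ (λ z → reach A k x z ∧ A z y) h in inj₂ (z , ∧-conicalˡ _ _ p , ∧-conicalʳ _ _ p)

  reach-cons : ∀ k {x z y} → A x z ≡ true → reach A k z y ≡ true → reach A (suc k) x y ≡ true
  reach-cons zero    {x} a r with reach-zero r
  ... | refl = reach-snoc 0 (reach-refl 0 x) a
  reach-cons (suc k) a r with reach-suc-elim k r
  ... | inj₁ r′             = reach-weaken (suc k) (reach-cons k a r′)
  ... | inj₂ (_ , r′ , a′) = reach-snoc (suc k) (reach-cons k a r′) a′

  module _ (A-sym : ∀ x y → A x y ≡ A y x) where

    reach-sym : ∀ k {x y} → reach A k x y ≡ true → reach A k y x ≡ true
    reach-sym zero    r with reach-zero r
    ... | refl = r
    reach-sym (suc k) {x} {y} r with reach-suc-elim k r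
    ... | inj₁ r′             = reach-weaken k (reach-sym k r′)
    ... | inj₂ (z , r′ , a) = reach-cons k (trans (A-sym y z) a) (reach-sym k r′)

    reach-comm : ∀ k x y → reach A k x y ≡ reach A k y x
    reach-comm k x y with reach A k x y in r | reach A k y x in r′
    ... | true  | true  = refl
    ... | false | false = refl
    ... | true  | false = trans (sym (reach-sym k r)) r′
    ... | false | true  = trans (sym r) (reach-sym k r′)

    dist-comm : ∀ x y → dist A x y ≡ dist A y x
    dist-comm x y = search-cong (λ k → reach-comm k x y) n
      where
      search-cong : ∀ {f g : ℕ → Bool} → (∀ k → f k ≡ g k) → ∀ b → search f b ≡ search g b
      search-cong f≗g zero    = refl
      search-cong f≗g (suc b) rewrite f≗g 0 | search-cong (f≗g ∘ suc) b = refl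

  adjacent⇒≢ : (∀ x → A x x ≡ false) → ∀ {x y} → A x y ≡ true → x ≢ y
  adjacent⇒≢ A-loopless {x} a refl with trans (sym (A-loopless x)) a
  ... | ()

  dist-adjacent : 2 ≤ n → (∀ x → A x x ≡ false) → ∀ {x y} → A x y ≡ true → dist A x y ≡ 1
  dist-adjacent (s≤s (s≤s {n = m} _)) A-loopless {x} {y} a = search-one (λ k → reach A k x y) m
    (cong ⌊_⌋ (≢-≟-identity _≟ᶠ_ (adjacent⇒≢ A-loopless a))) (reach-snoc 0 (reach-refl 0 x) a)
    where
    search-one : ∀ (f : ℕ → Bool) b → f 0 ≡ false → f 1 ≡ true → search f (suc (suc b)) ≡ 1
    search-one f b f0 f1 rewrite f0 | f1 = refl

≢-≢⇒≡-Fin2 : ∀ {a b c : Fin 2} → a ≢ c → b ≢ c → a ≡ b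
≢-≢⇒≡-Fin2 {zero}     {zero}     a≢c b≢c = refl
≢-≢⇒≡-Fin2 {suc zero} {suc zero} a≢c b≢c = refl
≢-≢⇒≡-Fin2 {zero}     {suc zero} {zero}     a≢c b≢c = ⊥-elim (a≢c refl)
≢-≢⇒≡-Fin2 {zero}     {suc zero} {suc zero} a≢c b≢c = ⊥-elim (b≢c refl)
≢-≢⇒≡-Fin2 {suc zero} {zero}     {zero}     a≢c b≢c = ⊥-elim (b≢c refl)
≢-≢⇒≡-Fin2 {suc zero} {zero}     {suc zero} a≢c b≢c = ⊥-elim (a≢c refl)

module EquilibriumArray
  {m} {A : Adj (suc (suc m))} (A-sym : ∀ x y → A x y ≡ A y x) (A-loopless : ∀ x → A x x ≡ false)
  {part : Fin (suc (suc m)) → Fin 2} (bipartite : IsBipartition A part)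
  {ν : Fin (suc (suc m)) → Fin (suc (suc m)) → ℚ} (ν-eq : ∀ y → IsEquilibriumMeasure A y (ν y))
  {q : Fin 2 → ℕ → ℚ} (q-arr : IsEquilibriumArray A part ν q)
  where

  ν-adjacent : ∀ {v z} → A v z ≡ true → ν v z ≡ q (part v) 1
  ν-adjacent {v} {z} a = trans (q-arr v z) (cong (q (part v)) (dist-adjacent A (s≤s (s≤s z≤n)) A-loopless a))

  deg-*-q₁ : ∀ v → ℕtoℚ (deg A v) * q (part v) 1 ≡ ℕtoℚ (suc m)
  deg-*-q₁ v = equilibrium-at-centre {A = A} (ν-eq v) (λ z → ν-adjacent)

  neighbour : ∀ y → ∃ λ w → A y w ≡ true
  neighbour y = count≢0⇒∃ (A y) (ℕtoℚ-*≡ℕtoℚ-suc⇒≢0 (deg A y) m (deg-*-q₁ y))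

  ν-comm-within-part : ∀ {a b} → part a ≡ part b → ν a b ≡ ν b a
  ν-comm-within-part {a} {b} e =
    trans (q-arr a b) (trans (cong₂ q e (dist-comm A A-sym a b)) (sym (q-arr b a)))

  ν-antisym-via-neighbour : ∀ {x y w} → A y w ≡ true → part w ≡ part x →
                            ν y x - ν x y ≡ q (part y) 1 - q (part x) 1
  ν-antisym-via-neighbour {x} {y} {w} a pw≡px = ℕtoℚ-suc-*-cancelˡ (suc m) (begin
    N * (ν y x - ν x y)       ≡⟨ equilibrium-reciprocity A-sym (ν-eq x) (ν-eq y) ⟩
    S y - S x                 ≡⟨ cong (λ t → S y - t) Sx≡Sw ⟩
    S y - S w                 ≡⟨ sym (equilibrium-reciprocity A-sym (ν-eq w) (ν-eq y)) ⟩
    N * (ν y w - ν w y)       ≡⟨ cong₂ (λ s t → N * (s - t)) (ν-adjacent a) νwy≡q₁ ⟩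
    N * (q (part y) 1 - q (part x) 1) ∎)
    where
    N = ℕtoℚ (suc (suc m))
    Sx≡Sw : sumℚ (ν x) ≡ sumℚ (ν w)
    Sx≡Sw = equilibrium-mass-≡ A-sym (ν-eq x) (ν-eq w) (ν-comm-within-part pw≡px)
    νwy≡q₁ : ν w y ≡ q (part x) 1
    νwy≡q₁ = trans (ν-adjacent (trans (A-sym w y) a)) (cong (λ p → q p 1) pw≡px)
    S : Fin (suc (suc m)) → ℚ
    S a = sumℚ (ν a)

  q-shift : ∀ x y → q (part y) (dist A x y) ≡ q (part x) (dist A x y) + (q (part y) 1 - q (part x) 1)
  q-shift x y with part x ≟ᶠ part y
  ... | yes px≡py rewrite px≡py = solve 2 (λ a b → a := a :+ (b :- b)) refl (q (part y) (dist A x y)) (q (part y) 1)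
  ... | no  px≢py = begin
    q (part y) (dist A x y)  ≡⟨ cong (q (part y)) (dist-comm A A-sym x y) ⟩
    q (part y) (dist A y x)  ≡⟨ sym (q-arr y x) ⟩
    ν y x                    ≡⟨ solve 2 (λ a b → a := b :+ (a :- b)) refl (ν y x) (ν x y) ⟩
    ν x y + (ν y x - ν x y)  ≡⟨ cong₂ _+_ (q-arr x y) (ν-antisym-via-neighbour a pw≡px) ⟩
    q (part x) (dist A x y) + (q (part y) 1 - q (part x) 1) ∎
    where
    w = proj₁ (neighbour y)
    a = proj₂ (neighbour y)
    pw≡px : part w ≡ part x
    pw≡px = ≢-≢⇒≡-Fin2 (λ pw≡py → bipartite y w a (sym pw≡py)) px≢py

corollary3p5 : (n : ℕ) → 2 ≤ n → (A : Adj n) → IsSimple A →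
    (part : Fin n → Fin 2) → (k : Fin 2 → ℕ) → IsDistanceBiregular A part k →
    (ν : Fin n → Fin n → ℚ) → (∀ (y : Fin n) → IsEquilibriumMeasure A y (ν y)) →
    (q : Fin 2 → ℕ → ℚ) → IsEquilibriumArray A part ν q →
    (ℓ ℓ̂ : Fin 2) → (x y : Fin n) → part y ≡ ℓ → part x ≡ ℓ̂ →
    q ℓ (dist A x y) ≡ q ℓ̂ (dist A x y) + ℕtoℚ (n ∸ 1) * (inv (k ℓ) - inv (k ℓ̂))
corollary3p5 (suc (suc m)) (s≤s (s≤s _)) A (A-sym , A-loopless) part k (_ , bipartite , deg≡k , _)
             ν ν-eq q q-arr _ _ x y refl refl = begin
  q (part y) d                                           ≡⟨ q-shift x y ⟩
  q (part x) d + (q (part y) 1 - q (part x) 1)           ≡⟨ cong₂ (λ s t → q (part x) d + (s - t)) (q₁ y) (q₁ x) ⟩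
  q (part x) d + (M * inv (k (part y)) - M * inv (k (part x)))
    ≡⟨ solve 4 (λ a M i j → a :+ (M :* i :- M :* j) := a :+ M :* (i :- j)) refl (q (part x) d) M (inv (k (part y))) (inv (k (part x))) ⟩
  q (part x) d + M * (inv (k (part y)) - inv (k (part x))) ∎
  where
  open EquilibriumArray A-sym A-loopless bipartite ν-eq {q} q-arr
  M = ℕtoℚ (suc m)
  d = dist A x y
  q₁ : ∀ v → q (part v) 1 ≡ M * inv (k (part v))
  q₁ v = ℕtoℚ-*≡⇒≡*inv (k (part v)) m (subst (λ K → ℕtoℚ K * q (part v) 1 ≡ M) (deg≡k v) (deg-*-q₁ v))
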